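{- For every $n\ge 2$, $f_6(n)\le\lceil\log_2 n\rceil+2\lceil\sqrt{\log_2 n}\,\rceil+2$.
   Context: Model 6 (adaptive, three players $A,B,C$). $X$ is an $n$-element set of distinguishable elements and Player $A$ (the adversary) chooses an unknown defective element $d\in X$. Players $B$ and $C$ may agree on a (deterministic) questioning strategy before the process starts, but cannot communicate afterwards except through the rules below. At each step Player $A$ decides which of $B$ and $C$ asks the next query; a query is a subset $Q\subseteq X$, whose answer is YES iff $d\in Q$. The player asking a query obtains its answer. If the answer to a query asked by $B$ is YES, then $C$ also learns the query set and that the answer was YES; similarly for queries asked by $C$ and answered YES, $B$ learns the set and the answer. If the answer is NO, the non-asking player learns nothing (not even that a query was asked). Each player's queries may depend only on the information that player has. The goal is that both $B$ and $C$ can identify $d$. $f_6(n)$ is the minimum $N$ such that $B$ and $C$ have a strategy guaranteeing that, whatever $d$ and whatever order of questioners $A$ chooses, the goal is reached after at most $N$ queries in total. -}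

module Defs where

open import Data.Nat using (ℕ; zero; suc; _+_; _*_; _≤_)
open import Data.Bool using (Bool; true; false; if_then_else_)
open import Data.Fin using (Fin)
open import Data.Fin.Subset using (Subset)
open import Data.Fin.Subset.Properties using (_∈?_)
open import Data.List using (List; []; _∷_)
open import Data.Product using (_×_; _,_; proj₁; proj₂; ∃-syntax; Σ-syntax)
open import Relation.Nullary using (does)
open import Relation.Binary.PropositionalEquality using (_≡_)

data Player : Set where
  B C : Player

-- An event in the private record of a player.
--   own Q a  : the player itself asked Q and received answer a (true = YES)
--   other Q  : the other player asked Q and got answer YES
-- (a NO answer to the other player's query leaves no trace at all)
data Event (n : ℕ) : Set where
  own   : Subset n → Bool → Event n
  other : Subset n → Event n

-- A player's whole information: the list of events, most recent first.
View : ℕ → Set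
View n = List (Event n)

Strategy : ℕ → Set
Strategy n = View n → Subset n

-- Order of questioners chosen by the adversary: the player asking query t.
Schedule : Set
Schedule = ℕ → Player

Views : ℕ → Set
Views n = View n × View n

step : ∀ {n} → Strategy n → Strategy n → Fin n → Player → Views n → Views n
step sB sC d B (vB , vC) with does (d ∈? sB vB)
... | true  = (own (sB vB) true ∷ vB , other (sB vB) ∷ vC)
... | false = (own (sB vB) false ∷ vB , vC)
step sB sC d C (vB , vC) with does (d ∈? sC vC)
... | true  = (other (sC vC) ∷ vB , own (sC vC) true ∷ vC)
... | false = (vB , own (sC vC) false ∷ vC)

run : ∀ {n} → Strategy n → Strategy n → Fin n → Schedule → ℕ → Views n
run sB sC d σ zero    = ([] , [])
run sB sC d σ (suc t) = step sB sC d (σ t) (run sB sC d σ t)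

viewOf : ∀ {n} → Player → Views n → View n
viewOf B = proj₁
viewOf C = proj₂

Identifies : ∀ {n} → Strategy n → Strategy n → Player → View n → Fin n → Set
Identifies sB sC p v d =
  ∀ d' (σ' : Schedule) t' → viewOf p (run sB sC d' σ' t') ≡ v → d' ≡ d

Solvable6 : ℕ → ℕ → Set
Solvable6 n N =
  Σ[ sB ∈ Strategy n ] Σ[ sC ∈ Strategy n ]
    (∀ (d : Fin n) (σ : Schedule) → ∃[ t ] (t ≤ N ×
       Identifies sB sC B (proj₁ (run sB sC d σ t)) d ×
       Identifies sB sC C (proj₂ (run sB sC d σ t)) d))

-- f₆(n) ≤ M  (f₆(n) is the least N with Solvable6 n N)
f6≤ : ℕ → ℕ → Set
f6≤ n M = ∃[ N ] (N ≤ M × Solvable6 n N)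

IsCeilSqrt : ℕ → ℕ → Set
IsCeilSqrt m k = m ≤ k * k × (∀ j → m ≤ j * j → k ≤ j)

{-# OPTIONS --safe #-}

-- Write the elements in binary with m = ⌈log₂ n⌉ digits.  B asks for the digits of d from
-- the most significant one down ("is this digit 0?"), C from the least significant one up
-- ("is this digit 1?").  A YES answer is seen by both players, a NO only by the asker, so a
-- player who has collected k = ⌈√m⌉ NO answers in a row, or who knows d, spends one query on
-- its whole candidate set: the answer is YES and tells the other player everything it knows.
-- Once the two directions meet, a digit that a player asks although the other has asked it
-- already was a private NO to the opposite question there, so now it gets a shared YES.
-- A potential worth about (k + 1) per unasked digit plus k (k + 1) in reserve drops by k
-- with every query, which bounds the game by m + 2k + 2 queries.

module Submission where

open import Defs
open import Data.Bool using (Bool; true; false; not; _∧_; if_then_else_)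
open import Data.Bool.Properties using (not-injective; not-involutive; not-¬) renaming (_≟_ to _≟ᵇ_)
open import Data.Fin as Fin using (Fin; toℕ)
open import Data.Fin.Properties using (toℕ<n; toℕ-injective; all?) renaming (_≟_ to _≟ᶠ_)
open import Data.Fin.Subset using (Subset)
open import Data.Fin.Subset.Properties using (_∈?_)
open import Data.List using ([]; _∷_)
open import Data.Nat
open import Data.Nat.Induction using (<-rec)
open import Data.Nat.Logarithm using (⌈log₂_⌉; ⌈log₂⌉-mono-≤; ⌈log₂2^n⌉≡n; ⌈log₂⌈n/2⌉⌉≡⌈log₂n⌉∸1)
open import Data.Nat.Properties
open import Data.Nat.Tactic.RingSolver using (solve-∀)
open import Data.Product as Product using (_×_; _,_; proj₁; proj₂; Σ-syntax; ∃-syntax)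
open import Data.Sum as Sum using (_⊎_; inj₁; inj₂)
open import Data.Vec using (tabulate)
open import Function using (_∘_)
open import Relation.Binary.PropositionalEquality
open import Relation.Nullary using (Dec; yes; no; does; ¬_; contradiction)
open import Relation.Nullary.Decidable using (_⊎-dec_; _→-dec_; dec-true; dec-false)

-- Binary digits

odd : ℕ → Bool
odd 0 = false
odd 1 = true
odd (suc (suc x)) = odd x

digit : ℕ → ℕ → Bool
digit zero    x = odd x
digit (suc p) x = digit p ⌊ x /2⌋

odd-⌊n/2⌋-injective : ∀ {x y} → odd x ≡ odd y → ⌊ x /2⌋ ≡ ⌊ y /2⌋ → x ≡ y
odd-⌊n/2⌋-injective {0}           {0}           _ _ = refl
odd-⌊n/2⌋-injective {0}           {1}           () _
odd-⌊n/2⌋-injective {0}           {suc (suc _)} _ ()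
odd-⌊n/2⌋-injective {1}           {0}           () _
odd-⌊n/2⌋-injective {1}           {1}           _ _ = refl
odd-⌊n/2⌋-injective {1}           {suc (suc _)} _ ()
odd-⌊n/2⌋-injective {suc (suc _)} {0}           _ ()
odd-⌊n/2⌋-injective {suc (suc _)} {1}           _ ()
odd-⌊n/2⌋-injective {suc (suc x)} {suc (suc y)} same-odd same-half =
  cong (suc ∘ suc) (odd-⌊n/2⌋-injective same-odd (suc-injective same-half))

⌊n/2⌋<2^m : ∀ m {x} → x < 2 ^ suc m → ⌊ x /2⌋ < 2 ^ m
⌊n/2⌋<2^m m {x} x<2^1+m = *-cancelˡ-< 2 ⌊ x /2⌋ (2 ^ m) (begin-strict
  2 * ⌊ x /2⌋        ≡⟨ cong (⌊ x /2⌋ +_) (+-identityʳ ⌊ x /2⌋) ⟩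
  ⌊ x /2⌋ + ⌊ x /2⌋  ≤⟨ +-monoʳ-≤ ⌊ x /2⌋ (⌊n/2⌋≤⌈n/2⌉ x) ⟩
  ⌊ x /2⌋ + ⌈ x /2⌉  ≡⟨ ⌊n/2⌋+⌈n/2⌉≡n x ⟩
  x                  <⟨ x<2^1+m ⟩
  2 ^ suc m          ∎)
  where open ≤-Reasoning

digits-injective : ∀ m {x y} → x < 2 ^ m → y < 2 ^ m →
                   (∀ {p} → p < m → digit p x ≡ digit p y) → x ≡ y
digits-injective zero    {zero}  {zero}  _ _ _ = refl
digits-injective zero    {suc _} (s≤s ()) _ _
digits-injective zero    {zero}  {suc _} _ (s≤s ()) _
digits-injective (suc m) x<2^1+m y<2^1+m same = odd-⌊n/2⌋-injective (same z<s)
  (digits-injective m (⌊n/2⌋<2^m m x<2^1+m) (⌊n/2⌋<2^m m y<2^1+m) (λ p<m → same (s<s p<m)))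

1≤⌈log₂n⌉ : ∀ {n} → 2 ≤ n → 1 ≤ ⌈log₂ n ⌉
1≤⌈log₂n⌉ {n} 2≤n = subst (_≤ ⌈log₂ n ⌉) (⌈log₂2^n⌉≡n 1) (⌈log₂⌉-mono-≤ {2} {n} 2≤n)

n≤2^⌈log₂n⌉ : ∀ n → n ≤ 2 ^ ⌈log₂ n ⌉
n≤2^⌈log₂n⌉ = <-rec (λ n → n ≤ 2 ^ ⌈log₂ n ⌉) bound
  where
  bound : ∀ n → (∀ {y} → y < n → y ≤ 2 ^ ⌈log₂ y ⌉) → n ≤ 2 ^ ⌈log₂ n ⌉
  bound 0             _   = z≤n
  bound 1             _   = s≤s z≤n
  bound n@(suc (suc k)) rec = begin
    n                                  ≡⟨ sym (⌊n/2⌋+⌈n/2⌉≡n n) ⟩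
    ⌊ n /2⌋ + ⌈ n /2⌉                  ≤⟨ +-monoˡ-≤ ⌈ n /2⌉ (⌊n/2⌋≤⌈n/2⌉ n) ⟩
    ⌈ n /2⌉ + ⌈ n /2⌉                  ≤⟨ +-mono-≤ half≤ half≤ ⟩
    2 ^ (L ∸ 1) + 2 ^ (L ∸ 1)          ≡⟨ cong (2 ^ (L ∸ 1) +_) (sym (+-identityʳ _)) ⟩
    2 ^ suc (L ∸ 1)                    ≡⟨ cong (2 ^_) (m+[n∸m]≡n (1≤⌈log₂n⌉ {n} (s≤s (s≤s z≤n)))) ⟩
    2 ^ L                              ∎
    where
    open ≤-Reasoning
    L = ⌈log₂ n ⌉
    half≤ : ⌈ n /2⌉ ≤ 2 ^ (L ∸ 1)
    half≤ = subst (λ e → ⌈ n /2⌉ ≤ 2 ^ e) (⌈log₂⌈n/2⌉⌉≡⌈log₂n⌉∸1 n) (rec (⌈n/2⌉<n k))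

bit : ∀ {n} → ℕ → Fin n → Bool
bit p x = digit p (toℕ x)

bits-injective : ∀ {n} m → n ≤ 2 ^ m → ∀ {x y : Fin n} → (∀ {p} → p < m → bit p x ≡ bit p y) → x ≡ y
bits-injective m n≤2^m {x} {y} same = toℕ-injective
  (digits-injective m (≤-trans (toℕ<n x) n≤2^m) (≤-trans (toℕ<n y) n≤2^m) same)

-- Views and identification

∈?-tabulate : ∀ {n} (f : Fin n → Bool) x → does (x ∈? tabulate f) ≡ f x
∈?-tabulate f Fin.zero with f Fin.zero
... | true  = refl
... | false = refl
∈?-tabulate f (Fin.suc x) = ∈?-tabulate (f ∘ Fin.suc) x

consistent : ∀ {n} → View n → Fin n → Bool
consistent []                x = true
consistent (own Q true  ∷ v) x = does (x ∈? Q) ∧ consistent v x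
consistent (own Q false ∷ v) x = not (does (x ∈? Q)) ∧ consistent v x
consistent (other Q     ∷ v) x = does (x ∈? Q) ∧ consistent v x

Pins : ∀ {n} → View n → Fin n → Set
Pins v d = ∀ x → consistent v x ≡ true → x ≡ d

Determines : ∀ {n} → View n → Set
Determines v = ∀ x y → consistent v x ≡ true → consistent v y ≡ true → x ≡ y

determines? : ∀ {n} (v : View n) → Dec (Determines v)
determines? v = all? λ x → all? λ y →
  (consistent v x ≟ᵇ true) →-dec (consistent v y ≟ᵇ true) →-dec (x ≟ᶠ y)

Admits : ∀ {n} → Views n → Fin n → Set
Admits (vB , vC) d = consistent vB d ≡ true × consistent vC d ≡ true

step-admits : ∀ {n} (sB sC : Strategy n) d p {vB vC} →
              Admits (vB , vC) d → Admits (step sB sC d p (vB , vC)) d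
step-admits sB sC d B {vB} (d∈vB , d∈vC) with does (d ∈? sB vB) in d∈Q
... | true  = cong₂ _∧_ d∈Q d∈vB , cong₂ _∧_ d∈Q d∈vC
... | false = cong₂ _∧_ (cong not d∈Q) d∈vB , d∈vC
step-admits sB sC d C {vC = vC} (d∈vB , d∈vC) with does (d ∈? sC vC) in d∈Q
... | true  = cong₂ _∧_ d∈Q d∈vB , cong₂ _∧_ d∈Q d∈vC
... | false = d∈vB , cong₂ _∧_ (cong not d∈Q) d∈vC

run-admits : ∀ {n} (sB sC : Strategy n) d σ t → Admits (run sB sC d σ t) d
run-admits sB sC d σ zero    = refl , refl
run-admits sB sC d σ (suc t) = step-admits sB sC d (σ t) (run-admits sB sC d σ t)

pins⇒identifies : ∀ {n} (sB sC : Strategy n) p {v d} → Pins v d → Identifies sB sC p v d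
pins⇒identifies sB sC B pins d′ σ′ t′ refl = pins d′ (proj₁ (run-admits sB sC d′ σ′ t′))
pins⇒identifies sB sC C pins d′ σ′ t′ refl = pins d′ (proj₂ (run-admits sB sC d′ σ′ t′))

-- The strategy

infix 7 _==_
_==_ : Bool → Bool → Bool
true  == w = w
false == w = not w

==⇒≡ : ∀ b w → b == w ≡ true → b ≡ w
==⇒≡ true  true  _ = refl
==⇒≡ false false _ = refl

==⇒≢ : ∀ b w → b == w ≡ false → b ≡ not w
==⇒≢ true  false _ = refl
==⇒≢ false true  _ = refl

module Protocol (n k : ℕ) where

  Confirms : ℕ → View n → Set
  Confirms z v = z ≡ k ⊎ Determines v

  confirms? : ∀ z v → Dec (Confirms z v)
  confirms? z v = (z ≟ k) ⊎-dec determines? v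

  -- (bit queries asked so far, NO answers received since the last YES or confirmation)
  counters : View n → ℕ × ℕ
  counters []            = 0 , 0
  counters (own Q b ∷ v) with counters v
  ... | a , z = if does (confirms? z v) then (a , 0) else (suc a , (if b then 0 else suc z))
  counters (other Q ∷ v) = counters v

  query : (ℕ → ℕ) → Bool → Strategy n
  query order w v with counters v
  ... | a , z = if does (confirms? z v)
                then tabulate (consistent v)
                else tabulate (λ x → consistent v x ∧ bit (order a) x == w)

  module _ {v a z} (counts : counters v ≡ (a , z)) where

    counters-confirm : ∀ {Q b} → Confirms z v → counters (own Q b ∷ v) ≡ (a , 0)
    counters-confirm c rewrite counts | dec-true (confirms? z v) c = refl

    counters-probe : ∀ {Q b} → ¬ Confirms z v →
                     counters (own Q b ∷ v) ≡ (suc a , (if b then 0 else suc z))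
    counters-probe ¬c rewrite counts | dec-false (confirms? z v) ¬c = refl

    ∈-query-confirm : ∀ {order w} → Confirms z v → ∀ x →
                      does (x ∈? query order w v) ≡ consistent v x
    ∈-query-confirm c x rewrite counts | dec-true (confirms? z v) c = ∈?-tabulate (consistent v) x

    ∈-query-probe : ∀ {order w} → ¬ Confirms z v → ∀ x →
                    does (x ∈? query order w v) ≡ (consistent v x ∧ bit (order a) x == w)
    ∈-query-probe {order} {w} ¬c x rewrite counts | dec-false (confirms? z v) ¬c =
      ∈?-tabulate (λ y → consistent v y ∧ bit (order a) y == w) x

-- Question orders

module Orders (m : ℕ) where

  Covers : (ℕ → ℕ) → (ℕ → ℕ) → Set
  Covers pP pO = ∀ {a b} → m ≤ a + b → ∀ {p} → p < m →
    (∃[ j ] j < a × pP j ≡ p) ⊎ (∃[ j ] j < b × pO j ≡ p)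

  Overtakes : (ℕ → ℕ) → (ℕ → ℕ) → Set
  Overtakes pP pO = ∀ {a r c} → a + r < m → m ≤ a + c → ∃[ j ] r ≤ j × j < c × pO j ≡ pP a

  covers-swap : ∀ {pP pO} → Covers pP pO → Covers pO pP
  covers-swap covers {a} {b} m≤a+b p<m = Sum.swap (covers (subst (m ≤_) (+-comm a b) m≤a+b) p<m)

  ascending descending : ℕ → ℕ
  ascending j = j
  descending j = m ∸ suc j

  descending-involutive : ∀ {p} → p < m → descending (descending p) ≡ p
  descending-involutive {p} p<m =
    trans (sym (pred[m∸n]≡m∸[1+n] m (m ∸ suc p))) (cong pred (m∸[m∸n]≡n p<m))

  descending-< : ∀ {a p} → p < m → m ≤ a + p → descending p < a
  descending-< {a} {p} p<m m≤a+p = subst (_≤ a) (+-∸-assoc 1 p<m)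
    (m≤n+o⇒m∸n≤o m p (subst (m ≤_) (+-comm a p) m≤a+p))

  covers-descending-ascending : Covers descending ascending
  covers-descending-ascending {a} {b} m≤a+b {p} p<m with p <? b
  ... | yes p<b = inj₂ (p , p<b , refl)
  ... | no  p≮b = inj₁ (descending p ,
    descending-< p<m (≤-trans m≤a+b (+-monoʳ-≤ a (≮⇒≥ p≮b))) , descending-involutive p<m)

  overtaken-at : ∀ {a r c} → a + r < m → m ≤ a + c → r ≤ descending a × descending a < c
  overtaken-at {a} {r} {c} a+r<m m≤a+c =
    m+n≤o⇒m≤o∸n r (subst (_≤ m) (+-comm (suc a) r) a+r<m) ,
    descending-< (≤-trans (s≤s (m≤m+n a r)) a+r<m) (subst (m ≤_) (+-comm a c) m≤a+c)

  overtakes-descending-ascending : Overtakes descending ascending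
  overtakes-descending-ascending {a} a+r<m m≤a+c =
    descending a , Product.map₂ (_, refl) (overtaken-at a+r<m m≤a+c)

  overtakes-ascending-descending : Overtakes ascending descending
  overtakes-ascending-descending {a} {r} a+r<m m≤a+c =
    descending a , Product.map₂ (_, descending-involutive (≤-trans (s≤s (m≤m+n a r)) a+r<m))
                                (overtaken-at a+r<m m≤a+c)

-- The potential

[m+n]∸[m+[n∸o]]≤o : ∀ m n o → (m + n) ∸ (m + (n ∸ o)) ≤ o
[m+n]∸[m+[n∸o]]≤o m n o = begin
  (m + n) ∸ (m + (n ∸ o)) ≡⟨ [m+n]∸[m+o]≡n∸o m n (n ∸ o) ⟩
  n ∸ (n ∸ o)             ≤⟨ m≤n+o⇒m∸n≤o n (n ∸ o) (subst (n ≤_) (+-comm o (n ∸ o)) (m≤n+m∸n n o)) ⟩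
  o                       ∎
  where open ≤-Reasoning

module Potential (m k : ℕ) where

  -- Before the two question orders meet (aP + aO < m) every unasked position is worth k + 1,
  -- with k (k + 1) in reserve; afterwards every position unknown to one of the players is
  -- worth k.
  Φ : ℕ → ℕ → ℕ → ℕ → ℕ
  Φ aP zP aO zO with aP + aO <? m
  ... | yes _ = suc k * (m ∸ (aP + aO)) + k * suc k
  ... | no  _ = k * suc ((m ∸ (aP + (aO ∸ zO))) ⊔ (m ∸ ((aP ∸ zP) + aO)))

  Ψ : ℕ → ℕ → ℕ → ℕ → ℕ
  Ψ aP zP aO zO = Φ aP zP aO zO + zP + zO

  module _ {aP zP aO zO : ℕ} where

    Φ-before : aP + aO < m → Φ aP zP aO zO ≡ suc k * (m ∸ (aP + aO)) + k * suc k
    Φ-before lt with aP + aO <? m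
    ... | yes _  = refl
    ... | no ¬lt = contradiction lt ¬lt

    Φ-after : m ≤ aP + aO →
              Φ aP zP aO zO ≡ k * suc ((m ∸ (aP + (aO ∸ zO))) ⊔ (m ∸ ((aP ∸ zP) + aO)))
    Φ-after ge with aP + aO <? m
    ... | yes lt = contradiction ge (<⇒≱ lt)
    ... | no  _  = refl

  Φ-swap : ∀ aP zP aO zO → Φ aP zP aO zO ≡ Φ aO zO aP zP
  Φ-swap aP zP aO zO with aP + aO <? m | aO + aP <? m
  ... | yes _  | yes _  = cong (λ s → suc k * (m ∸ s) + k * suc k) (+-comm aP aO)
  ... | yes lt | no ¬lt = contradiction (subst (_< m) (+-comm aP aO) lt) ¬lt
  ... | no ¬lt | yes lt = contradiction (subst (_< m) (+-comm aO aP) lt) ¬lt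
  ... | no  _  | no  _  = cong (λ g → k * suc g) (trans (⊔-comm (m ∸ (aP + (aO ∸ zO))) (m ∸ ((aP ∸ zP) + aO)))
      (cong₂ _⊔_ (cong (m ∸_) (+-comm (aP ∸ zP) aO)) (cong (m ∸_) (+-comm aP (aO ∸ zO)))))

  Ψ-swap : ∀ aP zP aO zO → Ψ aP zP aO zO ≡ Ψ aO zO aP zP
  Ψ-swap aP zP aO zO = trans (cong (λ φ → φ + zP + zO) (Φ-swap aP zP aO zO)) (rearrange _ zP zO)
    where
    rearrange : ∀ φ z z′ → φ + z + z′ ≡ φ + z′ + z
    rearrange = solve-∀

  Φ-monoᶻ : ∀ {aP zP zP′ aO zO} → zP ≤ zP′ → Φ aP zP aO zO ≤ Φ aP zP′ aO zO
  Φ-monoᶻ {aP} {aO = aO} {zO} zP≤zP′ with aP + aO <? m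
  ... | yes _ = ≤-refl
  ... | no  _ = *-monoʳ-≤ k (s≤s (⊔-monoʳ-≤ (m ∸ (aP + (aO ∸ zO)))
                  (∸-monoʳ-≤ m (+-monoˡ-≤ aO (∸-monoʳ-≤ aP zP≤zP′)))))

  Ψ-monoᶻ : ∀ {aP zP zP′ aO zO} → zP ≤ zP′ → Ψ aP zP aO zO ≤ Ψ aP zP′ aO zO
  Ψ-monoᶻ {zO = zO} zP≤zP′ = +-monoˡ-≤ zO (+-mono-≤ (Φ-monoᶻ zP≤zP′) zP≤zP′)

  Ψ-confirm : ∀ aP aO zO → Ψ aP 0 aO zO + k ≤ Ψ aP k aO zO
  Ψ-confirm aP aO zO = begin
    Φ aP 0 aO zO + 0 + zO + k  ≡⟨ rearrange (Φ aP 0 aO zO) zO k ⟩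
    Φ aP 0 aO zO + k + zO      ≤⟨ +-monoˡ-≤ zO (+-monoˡ-≤ k (Φ-monoᶻ z≤n)) ⟩
    Φ aP k aO zO + k + zO      ∎
    where
    open ≤-Reasoning
    rearrange : ∀ φ z k → φ + 0 + z + k ≡ φ + k + z
    rearrange = solve-∀

  Φ-advance : ∀ {aP zP zP′ aO zO zO′} → suc aP + aO < m → Φ (suc aP) zP aO zO + suc k ≡ Φ aP zP′ aO zO′
  Φ-advance {aP} {aO = aO} lt = begin
    Φ (suc aP) _ aO _ + suc k             ≡⟨ cong (_+ suc k) (Φ-before lt) ⟩
    suc k * r + k * suc k + suc k         ≡⟨ rearrange k r ⟩
    suc k * suc r + k * suc k             ≡⟨ cong (λ s → suc k * s + k * suc k) (+-∸-assoc 1 lt′) ⟨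
    suc k * (m ∸ (aP + aO)) + k * suc k   ≡⟨ Φ-before lt′ ⟨
    Φ aP _ aO _                           ∎
    where
    open ≡-Reasoning
    r = m ∸ suc (aP + aO)
    lt′ : aP + aO < m
    lt′ = ≤-trans (n≤1+n _) lt
    rearrange : ∀ k r → suc k * r + k * suc k + suc k ≡ suc k * suc r + k * suc k
    rearrange = solve-∀

  Ψ-at-crossing : ∀ {aP zP aO zO} → aP + aO ≡ m → zP ≤ k → zO ≤ k → Ψ aP zP aO zO ≤ k * suc k + zP + zO
  Ψ-at-crossing {aP} {zP} {aO} {zO} crossing zP≤k zO≤k = begin
    Φ aP zP aO zO + zP + zO
      ≡⟨ cong (λ φ → φ + zP + zO) (Φ-after (≤-reflexive (sym crossing))) ⟩
    k * suc ((m ∸ (aP + (aO ∸ zO))) ⊔ (m ∸ ((aP ∸ zP) + aO))) + zP + zO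
      ≤⟨ +-monoˡ-≤ zO (+-monoˡ-≤ zP (*-monoʳ-≤ k (s≤s (⊔-lub (≤-trans gapO zO≤k) (≤-trans gapP zP≤k))))) ⟩
    k * suc k + zP + zO
      ∎
    where
    open ≤-Reasoning
    gapO : m ∸ (aP + (aO ∸ zO)) ≤ zO
    gapO = subst (λ s → s ∸ (aP + (aO ∸ zO)) ≤ zO) crossing ([m+n]∸[m+[n∸o]]≤o aP aO zO)
    gapP : m ∸ ((aP ∸ zP) + aO) ≤ zP
    gapP = subst₂ (λ s t → s ∸ t ≤ zP) (trans (+-comm aO aP) crossing) (+-comm aO (aP ∸ zP))
                  ([m+n]∸[m+[n∸o]]≤o aO aP zP)

  Ψ-cross : ∀ {aP zP z′ aO zO} → suc (aP + aO) ≡ m → z′ ≤ k → z′ ≤ suc zP → zO ≤ k →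
            Ψ (suc aP) z′ aO zO + k ≤ Ψ aP zP aO zO
  Ψ-cross {aP} {zP} {z′} {aO} {zO} crossing z′≤k z′≤1+zP zO≤k = begin
    Ψ (suc aP) z′ aO zO + k                        ≤⟨ +-monoˡ-≤ k (Ψ-at-crossing crossing z′≤k zO≤k) ⟩
    k * suc k + z′ + zO + k                        ≤⟨ +-monoˡ-≤ k (+-monoˡ-≤ zO (+-monoʳ-≤ (k * suc k) z′≤1+zP)) ⟩
    k * suc k + suc zP + zO + k                    ≡⟨ rearrange k zP zO ⟩
    suc k * 1 + k * suc k + zP + zO                ≡⟨ cong (λ r → suc k * r + k * suc k + zP + zO) one ⟨
    suc k * (m ∸ (aP + aO)) + k * suc k + zP + zO  ≡⟨ cong (λ φ → φ + zP + zO) (Φ-before (≤-reflexive crossing)) ⟨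
    Ψ aP zP aO zO                                  ∎
    where
    open ≤-Reasoning
    one : m ∸ (aP + aO) ≡ 1
    one = subst (λ s → s ∸ (aP + aO) ≡ 1) crossing (m+n∸n≡m 1 (aP + aO))
    rearrange : ∀ k z z′ → k * suc k + suc z + z′ + k ≡ suc k * 1 + k * suc k + z + z′
    rearrange = solve-∀

  Ψ-yes-after : ∀ {aP aO zO} → m ≤ aP + aO → aP + (aO ∸ zO) < m → Ψ (suc aP) 0 aO zO + k ≤ Ψ aP 0 aO zO
  Ψ-yes-after {aP} {aO} {zO} m≤aP+aO lt = begin
    Φ (suc aP) 0 aO zO + 0 + zO + k
      ≡⟨ cong (λ φ → φ + 0 + zO + k) (Φ-after m≤1+aP+aO) ⟩
    k * suc (g ⊔ (m ∸ (suc aP + aO))) + 0 + zO + k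
      ≡⟨ cong (λ h → k * suc (g ⊔ h) + 0 + zO + k) (m≤n⇒m∸n≡0 m≤1+aP+aO) ⟩
    k * suc (g ⊔ 0) + 0 + zO + k
      ≡⟨ cong (λ h → k * suc h + 0 + zO + k) (⊔-identityʳ g) ⟩
    k * suc g + 0 + zO + k
      ≡⟨ rearrange k g zO ⟩
    k * suc (suc g) + 0 + zO
      ≤⟨ +-monoˡ-≤ zO (+-monoˡ-≤ 0 (*-monoʳ-≤ k (s≤s (m≤m⊔n (suc g) (m ∸ (aP + aO)))))) ⟩
    k * suc (suc g ⊔ (m ∸ (aP + aO))) + 0 + zO
      ≡⟨ cong (λ h → k * suc (h ⊔ (m ∸ (aP + aO))) + 0 + zO) (+-∸-assoc 1 lt) ⟨
    k * suc ((m ∸ (aP + (aO ∸ zO))) ⊔ (m ∸ (aP + aO))) + 0 + zO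
      ≡⟨ cong (λ φ → φ + 0 + zO) (Φ-after m≤aP+aO) ⟨
    Φ aP 0 aO zO + 0 + zO
      ∎
    where
    open ≤-Reasoning
    g = m ∸ suc (aP + (aO ∸ zO))
    m≤1+aP+aO : m ≤ suc aP + aO
    m≤1+aP+aO = m≤n⇒m≤1+n m≤aP+aO
    rearrange : ∀ k g z → k * suc g + 0 + z + k ≡ k * suc (suc g) + 0 + z
    rearrange = solve-∀

  Ψ-yes : ∀ {aP zP aO zO} → aP + (aO ∸ zO) < m → zO ≤ k → Ψ (suc aP) 0 aO zO + k ≤ Ψ aP zP aO zO
  Ψ-yes {aP} {zP} {aO} {zO} lt zO≤k = ≤-trans yes₀ (Ψ-monoᶻ z≤n)
    where
    yes₀ : Ψ (suc aP) 0 aO zO + k ≤ Ψ aP 0 aO zO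
    yes₀ with m ≤? suc aP + aO
    ... | no m≰1+aP+aO = ≤-trans (+-monoʳ-≤ (Ψ (suc aP) 0 aO zO) (n≤1+n k)) (≤-reflexive (begin
      Φ (suc aP) 0 aO zO + 0 + zO + suc k  ≡⟨ rearrange (Φ (suc aP) 0 aO zO) zO k ⟩
      Φ (suc aP) 0 aO zO + suc k + 0 + zO  ≡⟨ cong (λ φ → φ + 0 + zO) (Φ-advance (≰⇒> m≰1+aP+aO)) ⟩
      Φ aP 0 aO zO + 0 + zO                ∎))
      where
      open ≡-Reasoning
      rearrange : ∀ φ z k → φ + 0 + z + suc k ≡ φ + suc k + 0 + z
      rearrange = solve-∀
    ... | yes m≤1+aP+aO with m ≤? aP + aO
    ...   | no  m≰aP+aO = Ψ-cross (≤-antisym (≰⇒> m≰aP+aO) m≤1+aP+aO) z≤n z≤n zO≤k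
    ...   | yes m≤aP+aO = Ψ-yes-after m≤aP+aO lt

  Ψ-no : ∀ {aP zP aO zO} → aP + aO < m → zP < k → zO ≤ k → Ψ (suc aP) (suc zP) aO zO + k ≤ Ψ aP zP aO zO
  Ψ-no {aP} {zP} {aO} {zO} lt zP<k zO≤k with m ≤? suc aP + aO
  ... | no m≰1+aP+aO = ≤-reflexive (begin
    Φ (suc aP) (suc zP) aO zO + suc zP + zO + k  ≡⟨ rearrange (Φ (suc aP) (suc zP) aO zO) zP zO k ⟩
    Φ (suc aP) (suc zP) aO zO + suc k + zP + zO  ≡⟨ cong (λ φ → φ + zP + zO) (Φ-advance (≰⇒> m≰1+aP+aO)) ⟩
    Φ aP zP aO zO + zP + zO                      ∎)
    where
    open ≡-Reasoning
    rearrange : ∀ φ z z′ k → φ + suc z + z′ + k ≡ φ + suc k + z + z′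
    rearrange = solve-∀
  ... | yes m≤1+aP+aO = Ψ-cross (≤-antisym lt m≤1+aP+aO) zP<k ≤-refl zO≤k

  Ψ-initial : 1 ≤ m → m ≤ k * k → Ψ 0 0 0 0 + k ≤ k * (m + 2 * k + 2)
  Ψ-initial 1≤m m≤k*k = begin
    Φ 0 0 0 0 + 0 + 0 + k                  ≡⟨ cong (λ φ → φ + 0 + 0 + k) (Φ-before 1≤m) ⟩
    suc k * m + k * suc k + 0 + 0 + k      ≡⟨ expand k m ⟩
    k * m + m + (k * k + k + k)            ≤⟨ +-monoˡ-≤ (k * k + k + k) (+-monoʳ-≤ (k * m) m≤k*k) ⟩
    k * m + k * k + (k * k + k + k)        ≡⟨ collect k m ⟩
    k * (m + 2 * k + 2)                    ∎
    where
    open ≤-Reasoning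
    expand : ∀ k m → suc k * m + k * suc k + 0 + 0 + k ≡ k * m + m + (k * k + k + k)
    expand = solve-∀
    collect : ∀ k m → k * m + k * k + (k * k + k + k) ≡ k * (m + 2 * k + 2)
    collect = solve-∀

-- The invariant and one query

AgreeOn : ∀ {n} → (ℕ → ℕ) → ℕ → Fin n → Fin n → Set
AgreeOn order a x y = ∀ {j} → j < a → bit (order j) x ≡ bit (order j) y

AgreeOn-suc : ∀ {n order a} {x y : Fin n} →
              AgreeOn order a x y → bit (order a) x ≡ bit (order a) y → AgreeOn order (suc a) x y
AgreeOn-suc agree same j<1+a with m<1+n⇒m<n∨m≡n j<1+a
... | inj₁ j<a  = agree j<a
... | inj₂ refl = same

∧-true : ∀ {a b} → a ∧ b ≡ true → a ≡ true × b ≡ true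
∧-true {true} {true} _ = refl , refl

module Game (n m k : ℕ) where
  open Protocol n k
  open Orders m
  open Potential m k

  answer : Bool → Subset n → View n → View n → Views n
  answer true  Q vP vO = own Q true ∷ vP , other Q ∷ vO
  answer false Q vP vO = own Q false ∷ vP , vO

  Solved : Fin n → Views n → Set
  Solved d (vP , vO) = Pins vP d × Pins vO d

  TrailingNo : (ℕ → ℕ) → Bool → Fin n → ℕ → ℕ → Set
  TrailingNo order w d a z = ∀ {j} → a ∸ z ≤ j → j < a → bit (order j) d ≡ not w

  -- NO answers are private, so each player knows the other's positions only up to the
  -- other's current run of NO answers.
  record Invariant (pP : ℕ → ℕ) (wP : Bool) (pO : ℕ → ℕ) (wO : Bool)
                   (d : Fin n) (vP vO : View n) (aP zP aO zO : ℕ) : Set where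
    field
      countsP   : counters vP ≡ (aP , zP)
      countsO   : counters vO ≡ (aO , zO)
      knowsP    : ∀ x → consistent vP x ≡ true → AgreeOn pP aP x d × AgreeOn pO (aO ∸ zO) x d
      knowsO    : ∀ x → consistent vO x ≡ true → AgreeOn pO aO x d × AgreeOn pP (aP ∸ zP) x d
      trailingP : TrailingNo pP wP d aP zP
      trailingO : TrailingNo pO wO d aO zO
      zP≤k      : zP ≤ k
      zO≤k      : zO ≤ k

  invariant-swap : ∀ {pP wP pO wO d vP vO aP zP aO zO} →
                   Invariant pP wP pO wO d vP vO aP zP aO zO → Invariant pO wO pP wP d vO vP aO zO aP zP
  invariant-swap I = record
    { countsP = countsO ; countsO = countsP ; knowsP = knowsO ; knowsO = knowsP
    ; trailingP = trailingO ; trailingO = trailingP ; zP≤k = zO≤k ; zO≤k = zP≤k }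
    where open Invariant I

  ∃Invariant : (ℕ → ℕ) → Bool → (ℕ → ℕ) → Bool → Fin n → Views n → (ℕ → Set) → Set
  ∃Invariant pP wP pO wO d (vP , vO) Bound = Σ[ aP ∈ ℕ ] Σ[ zP ∈ ℕ ] Σ[ aO ∈ ℕ ] Σ[ zO ∈ ℕ ]
    (Invariant pP wP pO wO d vP vO aP zP aO zO × Bound (Ψ aP zP aO zO))

  Progress : (ℕ → ℕ) → Bool → (ℕ → ℕ) → Bool → Fin n → Views n → ℕ → Set
  Progress pP wP pO wO d vs ψ = Solved d vs ⊎ ∃Invariant pP wP pO wO d vs (λ ψ′ → ψ′ + k ≤ ψ)

  progress-swap : ∀ {pP wP pO wO d vs aP zP aO zO} → Progress pP wP pO wO d vs (Ψ aP zP aO zO) →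
                  Progress pO wO pP wP d (Product.swap vs) (Ψ aO zO aP zP)
  progress-swap (inj₁ solved) = inj₁ (Product.swap solved)
  progress-swap {aP = aP} {zP} {aO} {zO} (inj₂ (aP′ , zP′ , aO′ , zO′ , I , decrease)) =
    inj₂ (aO′ , zO′ , aP′ , zP′ , invariant-swap I ,
          subst₂ (λ ψ′ ψ → ψ′ + k ≤ ψ) (Ψ-swap aP′ zP′ aO′ zO′) (Ψ-swap aP zP aO zO) decrease)

  module Turn {pP wP pO wO} (opposite : wO ≡ not wP) (covers : Covers pP pO) (overtakes : Overtakes pP pO)
              (n≤2^m : n ≤ 2 ^ m) {d vP vO aP zP aO zO} (d∈vP : consistent vP d ≡ true)
              (I : Invariant pP wP pO wO d vP vO aP zP aO zO) where
    open Invariant I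

    Q : Subset n
    Q = query pP wP vP

    member-confirm : Confirms zP vP → ∀ x → does (x ∈? Q) ≡ consistent vP x
    member-confirm = ∈-query-confirm {vP} countsP {pP} {wP}

    covered⇒pins : m ≤ aP + (aO ∸ zO) → Pins vP d
    covered⇒pins m≤ x x∈vP = bits-injective m n≤2^m (λ p<m → agree (covers m≤ p<m))
      where
      agree : ∀ {p} → (∃[ j ] j < aP × pP j ≡ p) ⊎ (∃[ j ] j < aO ∸ zO × pO j ≡ p) → bit p x ≡ bit p d
      agree (inj₁ (j , j<aP , refl)) = proj₁ (knowsP x x∈vP) j<aP
      agree (inj₂ (j , j<rO , refl)) = proj₂ (knowsP x x∈vP) j<rO

    undetermined⇒uncovered : ¬ Determines vP → aP + (aO ∸ zO) < m
    undetermined⇒uncovered ¬det = ≰⇒> λ m≤ → ¬det λ x y x∈vP y∈vP →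
      trans (covered⇒pins m≤ x x∈vP) (sym (covered⇒pins m≤ y y∈vP))

    confirm-turn : Confirms zP vP → Progress pP wP pO wO d (own Q true ∷ vP , other Q ∷ vO) (Ψ aP zP aO zO)
    confirm-turn c@(inj₂ det) = inj₁
      ( (λ x x∈ → det x d (proj₂ (∧-true x∈)) d∈vP)
      , (λ x x∈ → det x d (trans (sym (member-confirm c x)) (proj₁ (∧-true x∈))) d∈vP) )
    confirm-turn c@(inj₁ zP≡k) = inj₂ (aP , 0 , aO , zO , record
      { countsP   = counters-confirm {vP} countsP {Q} c
      ; countsO   = countsO
      ; knowsP    = λ x x∈ → knowsP x (proj₂ (∧-true x∈))
      ; knowsO    = λ x x∈ → let (x∈Q , x∈vO) = ∧-true x∈ in
          proj₁ (knowsO x x∈vO) , proj₁ (knowsP x (trans (sym (member-confirm c x)) x∈Q))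
      ; trailingP = λ aP≤j j<aP → contradiction aP≤j (<⇒≱ j<aP)
      ; trailingO = trailingO
      ; zP≤k      = z≤n
      ; zO≤k      = zO≤k
      } , subst (λ z → Ψ aP 0 aO zO + k ≤ Ψ aP z aO zO) (sym zP≡k) (Ψ-confirm aP aO zO))

    module Probe (¬c : ¬ Confirms zP vP) where

      member : ∀ x → does (x ∈? Q) ≡ (consistent vP x ∧ bit (pP aP) x == wP)
      member = ∈-query-probe {vP} countsP {pP} {wP} ¬c

      answer-bit : does (d ∈? Q) ≡ bit (pP aP) d == wP
      answer-bit = trans (member d) (cong (_∧ _) d∈vP)

      yes-turn : bit (pP aP) d == wP ≡ true →
                 ∃Invariant pP wP pO wO d (own Q true ∷ vP , other Q ∷ vO) (λ ψ → ψ + k ≤ Ψ aP zP aO zO)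
      yes-turn same = suc aP , 0 , aO , zO , record
        { countsP   = counters-probe {vP} countsP {Q} ¬c
        ; countsO   = countsO
        ; knowsP    = λ x x∈ → let (x∈Q , x∈vP) = ∧-true x∈ in
            AgreeOn-suc {order = pP} (proj₁ (knowsP x x∈vP)) (agrees x x∈Q) , proj₂ (knowsP x x∈vP)
        ; knowsO    = λ x x∈ → let (x∈Q , x∈vO) = ∧-true x∈ in
            proj₁ (knowsO x x∈vO) ,
            AgreeOn-suc {order = pP} (proj₁ (knowsP x (proj₁ (Q⇒ x x∈Q)))) (agrees x x∈Q)
        ; trailingP = λ 1+aP≤j j<1+aP → contradiction 1+aP≤j (<⇒≱ j<1+aP)
        ; trailingO = trailingO
        ; zP≤k      = z≤n
        ; zO≤k      = zO≤k
        } , Ψ-yes (undetermined⇒uncovered (¬c ∘ inj₂)) zO≤k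
        where
        Q⇒ : ∀ x → does (x ∈? Q) ≡ true → consistent vP x ≡ true × bit (pP aP) x ≡ wP
        Q⇒ x x∈Q = Product.map₂ (==⇒≡ _ wP) (∧-true (trans (sym (member x)) x∈Q))
        agrees : ∀ x → does (x ∈? Q) ≡ true → bit (pP aP) x ≡ bit (pP aP) d
        agrees x x∈Q = trans (proj₂ (Q⇒ x x∈Q)) (sym (==⇒≡ _ wP same))

      no-turn : bit (pP aP) d == wP ≡ false →
                ∃Invariant pP wP pO wO d (own Q false ∷ vP , vO) (λ ψ → ψ + k ≤ Ψ aP zP aO zO)
      no-turn differs = suc aP , suc zP , aO , zO , record
        { countsP   = counters-probe {vP} countsP {Q} ¬c
        ; countsO   = countsO
        ; knowsP    = λ x x∈ → let (x∉Q , x∈vP) = ∧-true x∈ in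
            AgreeOn-suc {order = pP} (proj₁ (knowsP x x∈vP)) (agrees x x∈vP (not-injective x∉Q)) ,
            proj₂ (knowsP x x∈vP)
        ; knowsO    = knowsO
        ; trailingP = trailing
        ; trailingO = trailingO
        ; zP≤k      = zP<k
        ; zO≤k      = zO≤k
        } , Ψ-no not-crossed zP<k zO≤k
        where
        d-bit : bit (pP aP) d ≡ not wP
        d-bit = ==⇒≢ _ wP differs
        agrees : ∀ x → consistent vP x ≡ true → does (x ∈? Q) ≡ false → bit (pP aP) x ≡ bit (pP aP) d
        agrees x x∈vP x∉Q =
          trans (==⇒≢ _ wP (trans (sym (trans (member x) (cong (_∧ _) x∈vP))) x∉Q)) (sym d-bit)
        trailing : TrailingNo pP wP d (suc aP) (suc zP)
        trailing lo j<1+aP with m<1+n⇒m<n∨m≡n j<1+aP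
        ... | inj₁ j<aP = trailingP lo j<aP
        ... | inj₂ refl = d-bit
        zP<k : zP < k
        zP<k = ≤∧≢⇒< zP≤k (¬c ∘ inj₁)
        -- had the other player already asked this position, it got NO for the opposite question
        not-crossed : aP + aO < m
        not-crossed = ≰⇒> λ m≤aP+aO →
          let (j , rO≤j , j<aO , same-position) = overtakes (undetermined⇒uncovered (¬c ∘ inj₂)) m≤aP+aO
          in not-¬ (begin
               bit (pP aP) d  ≡⟨ cong (λ p → bit p d) same-position ⟨
               bit (pO j) d   ≡⟨ trailingO rO≤j j<aO ⟩
               not wO         ≡⟨ cong not opposite ⟩
               not (not wP)   ≡⟨ not-involutive wP ⟩
               wP             ∎) d-bit
          where open ≡-Reasoning

    respond : ∀ b → does (d ∈? Q) ≡ b → Progress pP wP pO wO d (answer b Q vP vO) (Ψ aP zP aO zO)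
    respond b answered with confirms? zP vP
    respond true  _        | yes c  = confirm-turn c
    respond false answered | yes c  =
      contradiction (trans (sym answered) (trans (member-confirm c d) d∈vP)) λ ()
    respond true  answered | no ¬c = inj₂ (Probe.yes-turn ¬c (trans (sym (Probe.answer-bit ¬c)) answered))
    respond false answered | no ¬c = inj₂ (Probe.no-turn ¬c (trans (sym (Probe.answer-bit ¬c)) answered))

    turn : Progress pP wP pO wO d (answer (does (d ∈? Q)) Q vP vO) (Ψ aP zP aO zO)
    turn = respond (does (d ∈? Q)) refl

-- Length of the game

module Play (n m k : ℕ) where
  open Protocol n k
  open Orders m
  open Potential m k
  open Game n m k

  strategyB strategyC : Strategy n
  strategyB = query descending false
  strategyC = query ascending true

  step-B : ∀ d vB vC →
           step strategyB strategyC d B (vB , vC) ≡ answer (does (d ∈? strategyB vB)) (strategyB vB) vB vC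
  step-B d vB vC with does (d ∈? strategyB vB)
  ... | true  = refl
  ... | false = refl

  step-C : ∀ d vB vC → step strategyB strategyC d C (vB , vC) ≡
           Product.swap (answer (does (d ∈? strategyC vC)) (strategyC vC) vC vB)
  step-C d vB vC with does (d ∈? strategyC vC)
  ... | true  = refl
  ... | false = refl

  round : n ≤ 2 ^ m → ∀ d p {vB vC aB zB aC zC} → Admits (vB , vC) d →
          Invariant descending false ascending true d vB vC aB zB aC zC →
          Progress descending false ascending true d (step strategyB strategyC d p (vB , vC)) (Ψ aB zB aC zC)
  round n≤2^m d B {vB} {vC} (d∈vB , _) I rewrite step-B d vB vC =
    Turn.turn refl covers-descending-ascending overtakes-descending-ascending n≤2^m d∈vB I
  round n≤2^m d C {vB} {vC} (_ , d∈vC) I rewrite step-C d vB vC =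
    progress-swap (Turn.turn refl (covers-swap covers-descending-ascending) overtakes-ascending-descending
                             n≤2^m d∈vC (invariant-swap I))

  invariant₀ : ∀ d → Invariant descending false ascending true d [] [] 0 0 0 0
  invariant₀ d = record
    { countsP = refl ; countsO = refl
    ; knowsP = λ _ _ → (λ ()) , (λ ())
    ; knowsO = λ _ _ → (λ ()) , (λ ())
    ; trailingP = λ _ () ; trailingO = λ _ ()
    ; zP≤k = z≤n ; zO≤k = z≤n }

  Outcome : Fin n → Schedule → ℕ → Set
  Outcome d σ t = (∃[ t′ ] t′ ≤ t × Solved d (run strategyB strategyC d σ t′))
    ⊎ ∃Invariant descending false ascending true d (run strategyB strategyC d σ t) (λ ψ → ψ + k * t ≤ Ψ 0 0 0 0)

  outcome : n ≤ 2 ^ m → ∀ d σ t → Outcome d σ t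
  outcome _ d σ zero =
    inj₂ (0 , 0 , 0 , 0 , invariant₀ d , ≤-reflexive (trans (cong (Ψ 0 0 0 0 +_) (*-zeroʳ k)) (+-identityʳ _)))
  outcome n≤2^m d σ (suc t) with outcome n≤2^m d σ t
  ... | inj₁ (t′ , t′≤t , solved) = inj₁ (t′ , m≤n⇒m≤1+n t′≤t , solved)
  ... | inj₂ (aB , zB , aC , zC , I , spent) with round n≤2^m d (σ t) (run-admits strategyB strategyC d σ t) I
  ...   | inj₁ solved = inj₁ (suc t , ≤-refl , solved)
  ...   | inj₂ (aB′ , zB′ , aC′ , zC′ , I′ , decrease) = inj₂ (aB′ , zB′ , aC′ , zC′ , I′ , (begin
    Ψ aB′ zB′ aC′ zC′ + k * suc t      ≡⟨ cong (Ψ aB′ zB′ aC′ zC′ +_) (*-suc k t) ⟩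
    Ψ aB′ zB′ aC′ zC′ + (k + k * t)    ≡⟨ +-assoc _ k (k * t) ⟨
    Ψ aB′ zB′ aC′ zC′ + k + k * t      ≤⟨ +-monoˡ-≤ (k * t) decrease ⟩
    Ψ aB zB aC zC + k * t              ≤⟨ spent ⟩
    Ψ 0 0 0 0                          ∎))
    where open ≤-Reasoning

  solved-within : n ≤ 2 ^ m → 1 ≤ k → ∀ {N} → Ψ 0 0 0 0 + k ≤ k * N →
                  ∀ d σ → ∃[ t ] t ≤ N × Solved d (run strategyB strategyC d σ t)
  solved-within n≤2^m 1≤k {N} budget d σ with outcome n≤2^m d σ N
  ... | inj₁ solved = solved
  ... | inj₂ (_ , _ , _ , _ , _ , spent) =
    contradiction (≤-trans (m≤n+m (k * N) _) spent) (<⇒≱ (<-≤-trans (m<m+n (Ψ 0 0 0 0) 1≤k) budget))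

theorem6 : ∀ (n k : ℕ) → 2 ≤ n → IsCeilSqrt ⌈log₂ n ⌉ k →
    f6≤ n (⌈log₂ n ⌉ + 2 * k + 2)
theorem6 n k 2≤n (m≤k*k , _) = m + 2 * k + 2 , ≤-refl , strategyB , strategyC , λ d σ →
  let (t , t≤N , pinsB , pinsC) = solved-within (n≤2^⌈log₂n⌉ n) 1≤k (Ψ-initial 1≤m m≤k*k) d σ
  in t , t≤N , pins⇒identifies strategyB strategyC B pinsB , pins⇒identifies strategyB strategyC C pinsC
  where
  m = ⌈log₂ n ⌉
  open Play n m k
  open Potential m k using (Ψ-initial)
  1≤m : 1 ≤ m
  1≤m = 1≤⌈log₂n⌉ 2≤n
  1≤k : 1 ≤ k
  1≤k = ≰⇒> λ k≤0 → <⇒≱ 1≤m (subst (λ j → m ≤ j * j) (n≤0⇒n≡0 k≤0) m≤k*k)
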